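{- Let $\lambda$ be a partition with $l(\lambda)\le n$, $z$ a content with $|z|=|\lambda|$, and $S_1\succ\cdots\succ S_K$ the semistandard tableaux of shape $\lambda$ and content $z$ in row word order. For $1\le i,j\le K$, the coefficient of $S_i$ in $D(S_j)$ (expressed in the basis $S_1,\dots,S_K$ of $\mathbb{C}^{F(\lambda,z)}/A(\lambda,z)$) equals $$\sum (-1)^d\,R(S_{b_d},S_{b_{d-1}})\cdots R(S_{b_1},S_{b_0})\,R(S_{b_0},S_i),$$ the sum over all $d\ge 0$ and sequences of positive integers $(b_0,\dots,b_d)$ with $i=b_0<b_1<\cdots<b_d=j$.
   Context: Fix $n\ge 2$. A partition $\lambda$ is identified with its Young diagram with column lengths $\zeta_1\ge\cdots\ge\zeta_{\lambda_1}$; $(r,c)$ is the box in row $r$, column $c$. A filling of shape $\lambda$ assigns a value in $\{1,\dots,n\}$ to each box; its content counts occurrences of each value. Semistandard tableau: filling with columns strictly increasing downward and rows weakly increasing. Same row content: row-by-row equality of multisets of entries. $F(\lambda,z)$: fillings of shape $\lambda$ and content $z$. $\mathfrak{S}_\lambda=\prod_c\mathfrak{S}_{\zeta_c}$ acts by $F_{\underline\pi}(r,c)=F(\pi_c(r),c)$, $\mathrm{sgn}(\underline\pi)=\prod_c\mathrm{sgn}(\pi_c)$. $R(F,S)=\sum\mathrm{sgn}(\underline\pi)$ over $\underline\pi\in\mathfrak{S}_\lambda$ with $F_{\underline\pi}$ having the same row content as $S$. $\mathbb{C}^{F(\lambda,z)}\subset\mathbb{C}^{F(n)}$ are the vector spaces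 with bases $F(\lambda,z)$ and all fillings with entries in $\{1,\dots,n\}$. $A(n)$ is spanned by (i) $E+F$ with $E,F$ of the same shape and content differing in one column by a transposition, and (ii) $E-\sum F'$ over all $F'$ obtained from $E$ by swapping the top $m$ entries of column $j+1$ with any $m$ entries of column $j$ (keeping vertical order), some $j,m$. $A(\lambda,z)=A(n)\cap\mathbb{C}^{F(\lambda,z)}$; the semistandard tableaux of shape $\lambda$, content $z$ give a basis of the quotient. Row word order: $E\prec F$ iff the word read from $E$ row by row (left to right, top to bottom) lexicographically precedes that of $F$. D-basis: recursively $D(S_i)=S_i-\sum_{j<i}R(S_i,S_j)\,D(S_j)$. -}

module Defs where

open import Data.Nat as ℕ using (ℕ; zero; suc; _≤_; _<_; _≥_; _≡ᵇ_; _<ᵇ_)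
open import Data.Integer as ℤ using (ℤ; +_; -_; _*_; _+_; _-_)
open import Data.Fin using (Fin; toℕ)
open import Data.List using (List; []; _∷_; [_]; map; concat; concatMap; length;
  filter; upTo; allFin; mapMaybe; foldr; _++_)
open import Data.Nat.ListAction using (sum)
open import Data.List.Relation.Unary.All using (All)
open import Data.List.Relation.Unary.Linked using (Linked)
open import Data.Maybe using (Maybe; just; nothing)
open import Data.Bool using (Bool; true; false; if_then_else_; _∧_)
open import Data.Product using (_×_; _,_)
open import Data.Unit using (⊤)
open import Data.Empty using (⊥)
open import Relation.Binary.PropositionalEquality using (_≡_)

IsPartition : List ℕ → Set
IsPartition la = Linked _≥_ la × All (0 <_) la

firstPart : List ℕ → ℕ
firstPart []      = 0
firstPart (x ∷ _) = x

columnLengths : List ℕ → List ℕ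
columnLengths la = map (λ c → length (filter (λ r → suc c ℕ.≤? r) la)) (upTo (firstPart la))

-- Fillings, stored as the list of their columns (each column read top to
-- bottom); box (r , c) is the r-th entry of the c-th column.

Filling : ℕ → Set
Filling n = List (List (Fin n))

HasShape : ∀ {n} → List ℕ → Filling n → Set
HasShape la F = map length F ≡ columnLengths la

countIn : ∀ {n} → Fin n → List (Fin n) → ℕ
countIn v xs = length (filter (λ x → toℕ x ℕ.≟ toℕ v) xs)

content : ∀ {n} → Filling n → Fin n → ℕ
content F v = sum (map (countIn v) F)

HasContent : ∀ {n} → (Fin n → ℕ) → Filling n → Set
HasContent z F = ∀ v → content F v ≡ z v

size : ∀ {n} → (Fin n → ℕ) → ℕ
size {n} z = sum (map z (allFin n))

nth : ∀ {A : Set} → List A → ℕ → Maybe A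
nth []       _       = nothing
nth (x ∷ xs) zero    = just x
nth (x ∷ xs) (suc k) = nth xs k

row : ∀ {n} → ℕ → Filling n → List (Fin n)
row r F = mapMaybe (λ col → nth col r) F

height : ∀ {n} → Filling n → ℕ
height []        = 0
height (col ∷ _) = length col

rows : ∀ {n} → Filling n → List (List (Fin n))
rows F = map (λ r → row r F) (upTo (height F))

-- consecutive columns: entries weakly increase along each row
RowWeak : ∀ {n} → List (Fin n) → List (Fin n) → Set
RowWeak _        []       = ⊤
RowWeak []       (_ ∷ _)  = ⊥
RowWeak (x ∷ xs) (y ∷ ys) = (toℕ x ≤ toℕ y) × RowWeak xs ys

IsSemistandard : ∀ {n} → Filling n → Set
IsSemistandard F = All (λ col → Linked _<_ (map toℕ col)) F × Linked RowWeak F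

data _<lex_ : List ℕ → List ℕ → Set where
  prefix : ∀ {y ys} → [] <lex (y ∷ ys)
  here   : ∀ {x y xs ys} → x < y → (x ∷ xs) <lex (y ∷ ys)
  there  : ∀ {x xs ys} → xs <lex ys → (x ∷ xs) <lex (x ∷ ys)

rowWord : ∀ {n} → Filling n → List ℕ
rowWord F = map toℕ (concat (rows F))

_≺_ : ∀ {n} → Filling n → Filling n → Set
E ≺ F = rowWord E <lex rowWord F

sgnPow : ℕ → ℤ
sgnPow zero    = + 1
sgnPow (suc k) = - sgnPow k

-- all ways to insert x into a list, with the sign (-1)^k of moving x
-- past k entries
insertions : ∀ {A : Set} → A → List A → List (ℤ × List A)
insertions x []       = (+ 1 , x ∷ []) ∷ []
insertions x (y ∷ ys) = (+ 1 , x ∷ y ∷ ys) ∷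
  map (λ { (s , p) → (- s , y ∷ p) }) (insertions x ys)

-- the multiset { (sgn π , xs ∘ π) | π ∈ 𝔖_{length xs} }
signedPerms : ∀ {A : Set} → List A → List (ℤ × List A)
signedPerms []       = (+ 1 , []) ∷ []
signedPerms (x ∷ xs) =
  concatMap (λ { (s , p) → map (λ { (t , q) → (s * t , q) }) (insertions x p) })
            (signedPerms xs)

-- the multiset { (sgn π̲ , F_π̲) | π̲ ∈ 𝔖_la = ∏_c 𝔖_{ζ_c} }
columnPerms : ∀ {A : Set} → List (List A) → List (ℤ × List (List A))
columnPerms []         = (+ 1 , []) ∷ []
columnPerms (c ∷ cs) =
  concatMap (λ { (s , p) → map (λ { (t , q) → (s * t , p ∷ q) }) (columnPerms cs) })
            (signedPerms c)

maxℕ : ℕ → ℕ → ℕ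
maxℕ = ℕ._⊔_

allB : ∀ {A : Set} → (A → Bool) → List A → Bool
allB p = foldr (λ a b → p a ∧ b) true

sameRowContent : ∀ {n} → Filling n → Filling n → Bool
sameRowContent {n} E F =
  allB (λ r → allB (λ v → countIn v (row r E) ≡ᵇ countIn v (row r F)) (allFin n))
       (upTo (maxℕ (height E) (height F)))

R : ∀ {n} → Filling n → Filling n → ℤ
R F S = foldr (λ { (s , G) acc → (if sameRowContent G S then s else + 0) + acc })
              (+ 0) (columnPerms F)

-- The matrix R(S_a,S_b) for a list of tableaux (0-indexed; 0 outside range)

Rmat : ∀ {n} → List (Filling n) → ℕ → ℕ → ℤ
Rmat Ss a b with nth Ss a | nth Ss b
... | just Sa | just Sb = R Sa Sb
... | _       | _       = + 0

-- D-basis: D(S_j) = S_j - Σ_{k<j} R(S_j,S_k) D(S_k), 0-indexed.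
-- An element Σ_i c_i S_i is recorded by its coefficient function i ↦ c_i.

Σ< : ℕ → (ℕ → ℤ) → ℤ
Σ< zero    f = + 0
Σ< (suc m) f = Σ< m f + f m

δ : ℕ → ℕ → ℤ
δ a b = if a ≡ᵇ b then + 1 else + 0

getD : List (ℕ → ℤ) → ℕ → (ℕ → ℤ)
getD Ds k with nth Ds k
... | just d  = d
... | nothing = λ _ → + 0

Dlist : (ℕ → ℕ → ℤ) → ℕ → List (ℕ → ℤ)
Dlist Rm zero    = []
Dlist Rm (suc m) = Dlist Rm m ++
  [ (λ i → δ m i - Σ< m (λ k → Rm m k * getD (Dlist Rm m) k i)) ]

Dcoef : (ℕ → ℕ → ℤ) → ℕ → ℕ → ℤ
Dcoef Rm j i = getD (Dlist Rm (suc j)) j i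

sublists : ∀ {A : Set} → List A → List (List A)
sublists []       = [] ∷ []
sublists (x ∷ xs) = let r = sublists xs in map (x ∷_) r ++ r

headIs : ℕ → List ℕ → Bool
headIs i []      = false
headIs i (b ∷ _) = i ≡ᵇ b

lastIs : ℕ → List ℕ → Bool
lastIs j []          = false
lastIs j (b ∷ [])    = j ≡ᵇ b
lastIs j (_ ∷ c ∷ r) = lastIs j (c ∷ r)

chains : ℕ → ℕ → List (List ℕ)
chains i j = filter (λ b → headIs i b ∧ lastIs j b Data.Bool.≟ true)
                    (sublists (upTo (suc j)))

pathProd : (ℕ → ℕ → ℤ) → List ℕ → ℤ
pathProd Rm (x ∷ y ∷ r) = Rm y x * pathProd Rm (y ∷ r)
pathProd Rm _           = + 1

firstOf : List ℕ → ℕ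
firstOf []      = 0
firstOf (b ∷ _) = b

chainSum : (ℕ → ℕ → ℤ) → ℕ → ℕ → ℤ
chainSum Rm i j = foldr (λ b acc →
    sgnPow (length b ℕ.∸ 1) * pathProd Rm b * Rm (firstOf b) i + acc)
  (+ 0) (chains i j)

-- First, for any matrix R with R i i = 1 the coefficients of the D-basis obey
-- D(j) = δ_j − Σ_{k<j} R j k D(k). The chain sums from i to k whose inner vertices lie below m obey
-- the same recursion in m (split off the largest inner vertex), so by strong induction on j the
-- chain sum equals the coefficient. Second, R(S,S) = 1 for a semistandard tableau S: the identity,
-- which occurs once in 𝔖_λ and with sign +1, is the only column permutation of S with the row
-- contents of S, because the top row of such a permutation is entrywise at least that of S (the
-- columns increase downward) and has the same sum, hence is equal, and one descends row by row.

module Submission where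

open import Defs
open import Data.Nat as ℕ using (ℕ; zero; suc; _≡ᵇ_; _≤_; _<_; z≤n; s≤s)
import Data.Nat.Properties as ℕ
open import Data.Nat.Induction using (<-rec)
open import Data.Nat.ListAction using (sum)
open import Data.Nat.ListAction.Properties using (sum-↭)
open import Data.Integer using (ℤ; 0ℤ; 1ℤ; -_; _*_; _+_; _-_)
import Data.Integer.Properties as ℤ
open import Data.Integer.Solver using (module +-*-Solver)
open import Algebra.Properties.CommutativeSemigroup ℤ.+-commutativeSemigroup
  using () renaming (interchange to +-interchange)
open import Data.Fin using (Fin; toℕ)
import Data.Fin.Properties as Fin
open import Data.List
  using (List; []; _∷_; [_]; _++_; _∷ʳ_; map; concat; concatMap; filter; length; drop; foldr;
         upTo; applyUpTo; allFin; lookup)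
import Data.List.Properties as List
open import Data.List.Membership.Propositional using (_∈_)
open import Data.List.Membership.Propositional.Properties
  using (∈-∃++; ∈-upTo⁺; ∈-allFin; ∈-lookup)
open import Data.List.Relation.Unary.All as All using (All; []; _∷_)
import Data.List.Relation.Unary.All.Properties as All
open import Data.List.Relation.Unary.Any using (here; there)
open import Data.List.Relation.Unary.AllPairs as AllPairs using (AllPairs; []; _∷_)
import Data.List.Relation.Unary.AllPairs.Properties as AllPairs
open import Data.List.Relation.Unary.Linked using (Linked; _∷_)
open import Data.List.Relation.Unary.Linked.Properties using (Linked⇒AllPairs)
open import Data.List.Relation.Unary.Unique.Propositional using (Unique)
open import Data.List.Relation.Binary.Pointwise using (Pointwise; []; _∷_)
open import Data.List.Relation.Binary.Permutation.Propositional
  using (_↭_; ↭-refl; ↭-sym; ↭-trans; prep; swap)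
open import Data.List.Relation.Binary.Permutation.Propositional.Properties
  using (↭-empty-inv; ¬x∷xs↭[]; ∈-resp-↭; All-resp-↭; drop-∷; ↭-length; filter-↭; shift)
  renaming (map⁺ to ↭-map⁺)
open import Data.Bool using (Bool; true; false; T; if_then_else_; _∧_)
import Data.Bool.Properties as Bool
open import Data.Maybe using (just; nothing)
open import Data.Empty using (⊥-elim)
open import Data.Product using (_×_; _,_; proj₁; proj₂)
open import Function using (_∘_; id)
open import Function.Bundles using (_⇔_; Equivalence)
open import Relation.Nullary using (yes; no; does)
open import Relation.Nullary.Decidable using (dec-true; dec-false)
open import Relation.Binary.Definitions using (DecidableEquality)
open import Relation.Binary.PropositionalEquality hiding ([_])
open ≡-Reasoning

private variable A B : Set

∑ : (A → ℤ) → List A → ℤ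
∑ f = foldr (λ x acc → f x + acc) 0ℤ

∑-++ : ∀ (f : A → ℤ) xs ys → ∑ f (xs ++ ys) ≡ ∑ f xs + ∑ f ys
∑-++ f []       ys = sym (ℤ.+-identityˡ _)
∑-++ f (x ∷ xs) ys = trans (cong (f x +_) (∑-++ f xs ys)) (sym (ℤ.+-assoc (f x) _ _))

∑-map : ∀ (f : B → ℤ) (g : A → B) xs → ∑ f (map g xs) ≡ ∑ (f ∘ g) xs
∑-map f g []       = refl
∑-map f g (x ∷ xs) = cong (f (g x) +_) (∑-map f g xs)

∑-cong : ∀ {f g : A → ℤ} → (∀ x → f x ≡ g x) → ∀ xs → ∑ f xs ≡ ∑ g xs
∑-cong f≗g []       = refl
∑-cong f≗g (x ∷ xs) = cong₂ _+_ (f≗g x) (∑-cong f≗g xs)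

∑-*ˡ : ∀ c (f : A → ℤ) xs → ∑ (λ x → c * f x) xs ≡ c * ∑ f xs
∑-*ˡ c f []       = sym (ℤ.*-zeroʳ c)
∑-*ˡ c f (x ∷ xs) = trans (cong (c * f x +_) (∑-*ˡ c f xs)) (sym (ℤ.*-distribˡ-+ c (f x) _))

∑-filter : ∀ (p : A → Bool) (f : A → ℤ) xs →
           ∑ f (filter (λ x → p x Data.Bool.≟ true) xs) ≡ ∑ (λ x → if p x then f x else 0ℤ) xs
∑-filter p f []       = refl
∑-filter p f (x ∷ xs) with p x
... | true  = cong (f x +_) (∑-filter p f xs)
... | false = trans (∑-filter p f xs) (sym (ℤ.+-identityˡ _))

∑-sublists-∷ʳ : ∀ (f : List A → ℤ) xs y →
  ∑ f (sublists (xs ∷ʳ y)) ≡ ∑ (λ s → f (s ∷ʳ y)) (sublists xs) + ∑ f (sublists xs)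
∑-sublists-∷ʳ f []       y = cong (_+ (f [] + 0ℤ)) (sym (ℤ.+-identityʳ (f [ y ])))
∑-sublists-∷ʳ f (x ∷ xs) y = begin
    ∑ f (map (x ∷_) (sublists (xs ∷ʳ y)) ++ sublists (xs ∷ʳ y))
  ≡⟨ ∑-++ f (map (x ∷_) (sublists (xs ∷ʳ y))) (sublists (xs ∷ʳ y)) ⟩
    ∑ f (map (x ∷_) (sublists (xs ∷ʳ y))) + ∑ f (sublists (xs ∷ʳ y))
  ≡⟨ cong₂ _+_ (trans (∑-map f (x ∷_) (sublists (xs ∷ʳ y))) (∑-sublists-∷ʳ (f ∘ (x ∷_)) xs y))
               (∑-sublists-∷ʳ f xs y) ⟩
    (a₁ + b₁) + (a₂ + b₂)
  ≡⟨ +-interchange a₁ b₁ a₂ b₂ ⟩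
    (a₁ + a₂) + (b₁ + b₂)
  ≡⟨ sym (cong₂ _+_ (split (λ s → f (s ∷ʳ y))) (split f)) ⟩
    ∑ (λ s → f (s ∷ʳ y)) (sublists (x ∷ xs)) + ∑ f (sublists (x ∷ xs))
  ∎
  where
  a₁ a₂ b₁ b₂ : ℤ
  a₁ = ∑ (λ s → f (x ∷ s ∷ʳ y)) (sublists xs)
  b₁ = ∑ (λ s → f (x ∷ s)) (sublists xs)
  a₂ = ∑ (λ s → f (s ∷ʳ y)) (sublists xs)
  b₂ = ∑ f (sublists xs)
  split : ∀ g → ∑ g (sublists (x ∷ xs)) ≡ ∑ (g ∘ (x ∷_)) (sublists xs) + ∑ g (sublists xs)
  split g = trans (∑-++ g (map (x ∷_) (sublists xs)) (sublists xs))
                  (cong (_+ ∑ g (sublists xs)) (∑-map g (x ∷_) (sublists xs)))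

∑-zero : ∀ {f : A → ℤ} → (∀ x → f x ≡ 0ℤ) → ∀ xs → ∑ f xs ≡ 0ℤ
∑-zero f≗0 []       = refl
∑-zero f≗0 (x ∷ xs) = cong₂ _+_ (f≗0 x) (∑-zero f≗0 xs)

∑-concatMap : ∀ (f : B → ℤ) (g : A → List B) xs → ∑ f (concatMap g xs) ≡ ∑ (∑ f ∘ g) xs
∑-concatMap f g []       = refl
∑-concatMap f g (x ∷ xs) =
  trans (∑-++ f (g x) (concat (map g xs))) (cong (∑ f (g x) +_) (∑-concatMap f g xs))

∑-congᴬ : ∀ {f g : A → ℤ} {xs} → All (λ x → f x ≡ g x) xs → ∑ f xs ≡ ∑ g xs
∑-congᴬ []         = refl
∑-congᴬ (fx≡gx ∷ ps) = cong₂ _+_ fx≡gx (∑-congᴬ ps)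

∑-sublists-upTo-vanish : ∀ {g : List ℕ → ℤ} {k} →
  g [] ≡ 0ℤ → (∀ s t → t < k → g (s ∷ʳ t) ≡ 0ℤ) → ∀ m → m ≤ k → ∑ g (sublists (upTo m)) ≡ 0ℤ
∑-sublists-upTo-vanish g[]≡0 g≡0 zero    _   = cong (_+ 0ℤ) g[]≡0
∑-sublists-upTo-vanish {g} g[]≡0 g≡0 (suc m) m<k = begin
    ∑ g (sublists (upTo (suc m)))
  ≡⟨ cong (∑ g ∘ sublists) (sym (List.upTo-∷ʳ m)) ⟩
    ∑ g (sublists (upTo m ∷ʳ m))
  ≡⟨ ∑-sublists-∷ʳ g (upTo m) m ⟩
    ∑ (λ s → g (s ∷ʳ m)) (sublists (upTo m)) + ∑ g (sublists (upTo m))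
  ≡⟨ cong₂ _+_ (∑-zero (λ s → g≡0 s m m<k) (sublists (upTo m)))
               (∑-sublists-upTo-vanish {g} g[]≡0 g≡0 m (ℕ.<⇒≤ m<k)) ⟩
    0ℤ
  ∎

-- Chain sums and the D-basis

≡ᵇ-refl : ∀ m → (m ≡ᵇ m) ≡ true
≡ᵇ-refl m = dec-true (m ℕ.≟ m) refl

≢⇒≡ᵇ-false : ∀ {m n} → m ≢ n → (m ≡ᵇ n) ≡ false
≢⇒≡ᵇ-false {m} {n} = dec-false (m ℕ.≟ n)

length-∷ʳ : ∀ (xs : List A) x → length (xs ∷ʳ x) ≡ suc (length xs)
length-∷ʳ xs x = trans (List.length-++ xs) (ℕ.+-comm (length xs) 1)

lastIs-∷ʳ : ∀ k s m → lastIs k (s ∷ʳ m) ≡ (k ≡ᵇ m)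
lastIs-∷ʳ k []          m = refl
lastIs-∷ʳ k (x ∷ [])    m = refl
lastIs-∷ʳ k (x ∷ y ∷ s) m = lastIs-∷ʳ k (y ∷ s) m

module ChainSums (Rm : ℕ → ℕ → ℤ) (i : ℕ) where

  chainTerm : List ℕ → ℤ
  chainTerm b = sgnPow (length b ℕ.∸ 1) * pathProd Rm b * Rm (firstOf b) i

  chainTermFrom : List ℕ → ℤ
  chainTermFrom b = if headIs i b then chainTerm b else 0ℤ

  -- the chains i = b₀ < ⋯ < b_d = k with b₀, …, b_{d-1} < m
  chainSumBelow : ℕ → ℕ → ℤ
  chainSumBelow m k = ∑ (λ s → chainTermFrom (s ∷ʳ k)) (sublists (upTo m))

  pathProd-∷ʳ : ∀ s m k → pathProd Rm (s ∷ʳ m ∷ʳ k) ≡ pathProd Rm (s ∷ʳ m) * Rm k m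
  pathProd-∷ʳ []          m k = trans (ℤ.*-identityʳ _) (sym (ℤ.*-identityˡ _))
  pathProd-∷ʳ (x ∷ [])    m k =
    trans (cong (Rm m x *_) (pathProd-∷ʳ [] m k)) (sym (ℤ.*-assoc (Rm m x) _ _))
  pathProd-∷ʳ (x ∷ y ∷ s) m k =
    trans (cong (Rm y x *_) (pathProd-∷ʳ (y ∷ s) m k)) (sym (ℤ.*-assoc (Rm y x) _ _))

  headIs-∷ʳ : ∀ s m k → headIs i (s ∷ʳ m ∷ʳ k) ≡ headIs i (s ∷ʳ m)
  headIs-∷ʳ []      m k = refl
  headIs-∷ʳ (x ∷ s) m k = refl

  firstOf-∷ʳ : ∀ s m k → firstOf (s ∷ʳ m ∷ʳ k) ≡ firstOf (s ∷ʳ m)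
  firstOf-∷ʳ []      m k = refl
  firstOf-∷ʳ (x ∷ s) m k = refl

  chainTerm-∷ʳ : ∀ s m k → chainTerm (s ∷ʳ m ∷ʳ k) ≡ - Rm k m * chainTerm (s ∷ʳ m)
  chainTerm-∷ʳ s m k
    rewrite length-∷ʳ (s ∷ʳ m) k | length-∷ʳ s m | pathProd-∷ʳ s m k | firstOf-∷ʳ s m k =
    solve 4 (λ σ p r f → (:- σ) :* (p :* r) :* f := (:- r) :* (σ :* p :* f)) refl
      (sgnPow (length s)) (pathProd Rm (s ∷ʳ m)) (Rm k m) (Rm (firstOf (s ∷ʳ m)) i)
    where open +-*-Solver

  chainTermFrom-∷ʳ : ∀ s m k → chainTermFrom (s ∷ʳ m ∷ʳ k) ≡ - Rm k m * chainTermFrom (s ∷ʳ m)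
  chainTermFrom-∷ʳ s m k rewrite headIs-∷ʳ s m k with headIs i (s ∷ʳ m)
  ... | true  = chainTerm-∷ʳ s m k
  ... | false = sym (ℤ.*-zeroʳ (- Rm k m))

  chainSumBelow-suc : ∀ m k → chainSumBelow (suc m) k ≡ - Rm k m * chainSumBelow m m + chainSumBelow m k
  chainSumBelow-suc m k = begin
      chainSumBelow (suc m) k
    ≡⟨ cong (∑ (λ s → chainTermFrom (s ∷ʳ k)) ∘ sublists) (sym (List.upTo-∷ʳ m)) ⟩
      ∑ (λ s → chainTermFrom (s ∷ʳ k)) (sublists (upTo m ∷ʳ m))
    ≡⟨ ∑-sublists-∷ʳ (λ s → chainTermFrom (s ∷ʳ k)) (upTo m) m ⟩
      ∑ (λ s → chainTermFrom (s ∷ʳ m ∷ʳ k)) (sublists (upTo m)) + chainSumBelow m k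
    ≡⟨ cong (_+ chainSumBelow m k) (∑-cong (λ s → chainTermFrom-∷ʳ s m k) (sublists (upTo m))) ⟩
      ∑ (λ s → - Rm k m * chainTermFrom (s ∷ʳ m)) (sublists (upTo m)) + chainSumBelow m k
    ≡⟨ cong (_+ chainSumBelow m k) (∑-*ˡ (- Rm k m) (λ s → chainTermFrom (s ∷ʳ m)) (sublists (upTo m))) ⟩
      - Rm k m * chainSumBelow m m + chainSumBelow m k
    ∎

  chainSumBelow-rec : ∀ m k →
    chainSumBelow m k ≡ chainTermFrom [ k ] - Σ< m (λ t → Rm k t * chainSumBelow t t)
  chainSumBelow-rec zero    k = refl
  chainSumBelow-rec (suc m) k rewrite chainSumBelow-suc m k | chainSumBelow-rec m k =
    solve 4 (λ r c b σ → (:- r) :* c :+ (b :- σ) := b :- (σ :+ r :* c)) refl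
      (Rm k m) (chainSumBelow m m) (chainTermFrom [ k ]) (Σ< m (λ t → Rm k t * chainSumBelow t t))
    where open +-*-Solver

  chainSum≡chainSumBelow : ∀ j → chainSum Rm i j ≡ chainSumBelow j j
  chainSum≡chainSumBelow j = begin
      chainSum Rm i j
    ≡⟨ ∑-filter (λ b → headIs i b ∧ lastIs j b) chainTerm (sublists (upTo (suc j))) ⟩
      ∑ chainTermTo (sublists (upTo (suc j)))
    ≡⟨ cong (∑ chainTermTo ∘ sublists) (sym (List.upTo-∷ʳ j)) ⟩
      ∑ chainTermTo (sublists (upTo j ∷ʳ j))
    ≡⟨ ∑-sublists-∷ʳ chainTermTo (upTo j) j ⟩
      ∑ (λ s → chainTermTo (s ∷ʳ j)) (sublists (upTo j)) + ∑ chainTermTo (sublists (upTo j))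
    ≡⟨ cong₂ _+_ (∑-cong endsAtj (sublists (upTo j)))
                 (∑-sublists-upTo-vanish {chainTermTo} refl endsBeforej j ℕ.≤-refl) ⟩
      chainSumBelow j j + 0ℤ
    ≡⟨ ℤ.+-identityʳ _ ⟩
      chainSumBelow j j
    ∎
    where
    chainTermTo : List ℕ → ℤ
    chainTermTo b = if headIs i b ∧ lastIs j b then chainTerm b else 0ℤ

    endsAtj : ∀ s → chainTermTo (s ∷ʳ j) ≡ chainTermFrom (s ∷ʳ j)
    endsAtj s rewrite lastIs-∷ʳ j s j | ≡ᵇ-refl j | Bool.∧-identityʳ (headIs i (s ∷ʳ j)) = refl

    endsBeforej : ∀ s t → t < j → chainTermTo (s ∷ʳ t) ≡ 0ℤ
    endsBeforej s t t<j
      rewrite lastIs-∷ʳ j s t | ≢⇒≡ᵇ-false (ℕ.>⇒≢ t<j) | Bool.∧-zeroʳ (headIs i (s ∷ʳ t)) = refl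

  chainTermFrom-singleton : Rm i i ≡ 1ℤ → ∀ k → chainTermFrom [ k ] ≡ δ k i
  chainTermFrom-singleton Rii k with i ℕ.≟ k
  ... | yes refl rewrite ≡ᵇ-refl i = trans (ℤ.*-identityˡ (Rm i i)) Rii
  ... | no  i≢k  rewrite ≢⇒≡ᵇ-false i≢k | ≢⇒≡ᵇ-false (≢-sym i≢k) = refl

getD-just : ∀ Ds k {d} → nth Ds k ≡ just d → getD Ds k ≡ d
getD-just Ds k eq rewrite eq = refl

nth-∷ʳ-length : ∀ (xs : List A) x → nth (xs ∷ʳ x) (length xs) ≡ just x
nth-∷ʳ-length []       x = refl
nth-∷ʳ-length (_ ∷ xs) x = nth-∷ʳ-length xs x

nth-map-applyUpTo : ∀ (f : B → A) g {k m} → k < m → nth (map f (applyUpTo g m)) k ≡ just (f (g k))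
nth-map-applyUpTo f g {zero}  {suc m} _         = refl
nth-map-applyUpTo f g {suc k} {suc m} (s≤s k<m) = nth-map-applyUpTo f (g ∘ suc) k<m

Σ<-cong : ∀ m {f g : ℕ → ℤ} → (∀ k → k < m → f k ≡ g k) → Σ< m f ≡ Σ< m g
Σ<-cong zero    f≗g = refl
Σ<-cong (suc m) f≗g = cong₂ _+_ (Σ<-cong m (λ k k<m → f≗g k (ℕ.m<n⇒m<1+n k<m))) (f≗g m ℕ.≤-refl)

module DBasis (Rm : ℕ → ℕ → ℤ) where

  Dnext : ℕ → ℕ → ℤ
  Dnext m i = δ m i - Σ< m (λ k → Rm m k * getD (Dlist Rm m) k i)

  length-Dlist : ∀ m → length (Dlist Rm m) ≡ m
  length-Dlist zero    = refl
  length-Dlist (suc m) = trans (length-∷ʳ (Dlist Rm m) (Dnext m)) (cong suc (length-Dlist m))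

  Dcoef≡Dnext : ∀ m → Dcoef Rm m ≡ Dnext m
  Dcoef≡Dnext m = getD-just (Dlist Rm m ∷ʳ Dnext m) m
    (subst (λ k → nth (Dlist Rm m ∷ʳ Dnext m) k ≡ just (Dnext m)) (length-Dlist m) (nth-∷ʳ-length (Dlist Rm m) (Dnext m)))

  Dlist≡map-Dcoef : ∀ m → Dlist Rm m ≡ map (Dcoef Rm) (upTo m)
  Dlist≡map-Dcoef zero    = refl
  Dlist≡map-Dcoef (suc m) = begin
      Dlist Rm m ∷ʳ Dnext m
    ≡⟨ cong₂ _∷ʳ_ (Dlist≡map-Dcoef m) (sym (Dcoef≡Dnext m)) ⟩
      map (Dcoef Rm) (upTo m) ∷ʳ Dcoef Rm m
    ≡⟨ sym (List.map-++ (Dcoef Rm) (upTo m) [ m ]) ⟩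
      map (Dcoef Rm) (upTo m ∷ʳ m)
    ≡⟨ cong (map (Dcoef Rm)) (List.upTo-∷ʳ m) ⟩
      map (Dcoef Rm) (upTo (suc m))
    ∎

  getD-Dlist : ∀ {k m} → k < m → getD (Dlist Rm m) k ≡ Dcoef Rm k
  getD-Dlist {k} {m} k<m =
    getD-just (Dlist Rm m) k (trans (cong (λ Ds → nth Ds k) (Dlist≡map-Dcoef m)) (nth-map-applyUpTo (Dcoef Rm) id k<m))

  Dcoef-rec : ∀ j i → Dcoef Rm j i ≡ δ j i - Σ< j (λ k → Rm j k * Dcoef Rm k i)
  Dcoef-rec j i = trans (cong (λ d → d i) (Dcoef≡Dnext j))
    (cong (λ σ → δ j i - σ) (Σ<-cong j (λ k k<j → cong (λ d → Rm j k * d i) (getD-Dlist k<j))))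

Dcoef≡chainSum : ∀ (Rm : ℕ → ℕ → ℤ) i → Rm i i ≡ 1ℤ → ∀ j → Dcoef Rm j i ≡ chainSum Rm i j
Dcoef≡chainSum Rm i Rii j = trans (<-rec (λ j → Dcoef Rm j i ≡ chainSumBelow j j) step j)
                                  (sym (chainSum≡chainSumBelow j))
  where
  open ChainSums Rm i
  open DBasis Rm
  step : ∀ j → (∀ {k} → k < j → Dcoef Rm k i ≡ chainSumBelow k k) →
         Dcoef Rm j i ≡ chainSumBelow j j
  step j ih = begin
      Dcoef Rm j i
    ≡⟨ Dcoef-rec j i ⟩
      δ j i - Σ< j (λ k → Rm j k * Dcoef Rm k i)
    ≡⟨ cong₂ _-_ (sym (chainTermFrom-singleton Rii j))
                 (Σ<-cong j (λ k k<j → cong (Rm j k *_) (ih k<j))) ⟩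
      chainTermFrom [ j ] - Σ< j (λ k → Rm j k * chainSumBelow k k)
    ≡⟨ sym (chainSumBelow-rec j j) ⟩
      chainSumBelow j j
    ∎

-- Signed column permutations

All-concatMap⁺ : ∀ {P : B → Set} (g : A → List B) {xs} → All (All P ∘ g) xs → All P (concatMap g xs)
All-concatMap⁺ g ps = All.concat⁺ (All.map⁺ ps)

insertions-↭ : ∀ (x : A) p → All (λ a → proj₂ a ↭ x ∷ p) (insertions x p)
insertions-↭ x []       = ↭-refl ∷ []
insertions-↭ x (y ∷ ys) =
  ↭-refl ∷ All.map⁺ (All.map (λ q↭ → ↭-trans (prep y q↭) (swap y x ↭-refl)) (insertions-↭ x ys))

signedPerms-↭ : ∀ (xs : List A) → All (λ a → proj₂ a ↭ xs) (signedPerms xs)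
signedPerms-↭ []       = ↭-refl ∷ []
signedPerms-↭ (x ∷ xs) = All-concatMap⁺ _
  (All.map (λ {a} p↭ → All.map⁺ (All.map (λ q↭ → ↭-trans q↭ (prep x p↭)) (insertions-↭ x (proj₂ a))))
           (signedPerms-↭ xs))

columnPerms-↭ : ∀ (Cs : List (List A)) → All (λ a → Pointwise _↭_ (proj₂ a) Cs) (columnPerms Cs)
columnPerms-↭ []       = [] ∷ []
columnPerms-↭ (c ∷ cs) = All-concatMap⁺ _
  (All.map (λ p↭ → All.map⁺ (All.map (p↭ ∷_) (columnPerms-↭ cs))) (signedPerms-↭ c))

module _ (_≟_ : DecidableEquality B) where

  signAt : B → ℤ × B → ℤ
  signAt b (s , p) = if does (p ≟ b) then s else 0ℤ

  signAt-≡ : ∀ {b s p} → p ≡ b → signAt b (s , p) ≡ s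
  signAt-≡ {b} {s} {p} p≡b rewrite dec-true (p ≟ b) p≡b = refl

  signAt-≢ : ∀ {b s p} → p ≢ b → signAt b (s , p) ≡ 0ℤ
  signAt-≢ {b} {s} {p} p≢b rewrite dec-false (p ≟ b) p≢b = refl

  signAt-* : ∀ b s t p → s * signAt b (t , p) ≡ signAt b (s * t , p)
  signAt-* b s t p with does (p ≟ b)
  ... | true  = refl
  ... | false = ℤ.*-zeroʳ s

module _ (_≟_ : DecidableEquality B) where

  signAt-∷ : ∀ x xs s t y p →
    signAt (List.≡-dec _≟_) (x ∷ xs) (s * t , y ∷ p)
      ≡ signAt _≟_ x (s , y) * signAt (List.≡-dec _≟_) xs (t , p)
  signAt-∷ x xs s t y p with y ≟ x | List.≡-dec _≟_ p xs
  ... | yes _ | yes _ = refl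
  ... | yes _ | no  _ = sym (ℤ.*-zeroʳ s)
  ... | no  _ | _     = refl

module _ (_≟_ : DecidableEquality A) where

  private
    _≟ₗ_ : DecidableEquality (List A)
    _≟ₗ_ = List.≡-dec _≟_

    firstInsertion : ∀ x xs s p → signAt _≟ₗ_ (x ∷ xs) (s * 1ℤ , x ∷ p) ≡ signAt _≟ₗ_ xs (s , p)
    firstInsertion x xs s p = begin
        signAt _≟ₗ_ (x ∷ xs) (s * 1ℤ , x ∷ p)
      ≡⟨ signAt-∷ _≟_ x xs s 1ℤ x p ⟩
        signAt _≟_ x (s , x) * signAt _≟ₗ_ xs (1ℤ , p)
      ≡⟨ cong (_* signAt _≟ₗ_ xs (1ℤ , p)) (signAt-≡ _≟_ refl) ⟩
        s * signAt _≟ₗ_ xs (1ℤ , p)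
      ≡⟨ signAt-* _≟ₗ_ xs s 1ℤ p ⟩
        signAt _≟ₗ_ xs (s * 1ℤ , p)
      ≡⟨ cong (λ t → signAt _≟ₗ_ xs (t , p)) (ℤ.*-identityʳ s) ⟩
        signAt _≟ₗ_ xs (s , p)
      ∎

  ∑-insertions-signAt : ∀ x xs s p → All (x ≢_) p →
    ∑ (λ a → signAt _≟ₗ_ (x ∷ xs) (s * proj₁ a , proj₂ a)) (insertions x p) ≡ signAt _≟ₗ_ xs (s , p)
  ∑-insertions-signAt x xs s []       _           = trans (ℤ.+-identityʳ _) (firstInsertion x xs s [])
  ∑-insertions-signAt x xs s (y ∷ ys) (x≢y ∷ _) =
    trans (cong₂ _+_ (firstInsertion x xs s (y ∷ ys)) laterInsertions) (ℤ.+-identityʳ _)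
    where
    laterInsertions : ∑ (λ a → signAt _≟ₗ_ (x ∷ xs) (s * proj₁ a , proj₂ a))
                        (map (λ { (t , q) → (- t , y ∷ q) }) (insertions x ys)) ≡ 0ℤ
    laterInsertions = trans (∑-map (λ a → signAt _≟ₗ_ (x ∷ xs) (s * proj₁ a , proj₂ a)) _ (insertions x ys))
                            (∑-zero laterInsertion (insertions x ys))
      where
      laterInsertion : ∀ a → signAt _≟ₗ_ (x ∷ xs) (s * - proj₁ a , y ∷ proj₂ a) ≡ 0ℤ
      laterInsertion (t , q) = trans (signAt-∷ _≟_ x xs s (- t) y q)
                                     (cong (_* signAt _≟ₗ_ xs (- t , q)) (signAt-≢ _≟_ (x≢y ∘ sym)))

  ∑-signedPerms-signAt : ∀ xs → Unique xs → ∑ (signAt _≟ₗ_ xs) (signedPerms xs) ≡ 1ℤ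
  ∑-signedPerms-signAt []       _             = refl
  ∑-signedPerms-signAt (x ∷ xs) (x∉xs ∷ !xs) = begin
      ∑ (signAt _≟ₗ_ (x ∷ xs)) (signedPerms (x ∷ xs))
    ≡⟨ ∑-concatMap (signAt _≟ₗ_ (x ∷ xs)) _ (signedPerms xs) ⟩
      ∑ (λ a → ∑ (signAt _≟ₗ_ (x ∷ xs)) (map (λ { (t , q) → (proj₁ a * t , q) }) (insertions x (proj₂ a))))
        (signedPerms xs)
    ≡⟨ ∑-congᴬ (All.map insertionsOf (signedPerms-↭ xs)) ⟩
      ∑ (signAt _≟ₗ_ xs) (signedPerms xs)
    ≡⟨ ∑-signedPerms-signAt xs !xs ⟩
      1ℤ
    ∎
    where
    insertionsOf : ∀ {a} → proj₂ a ↭ xs →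
      ∑ (signAt _≟ₗ_ (x ∷ xs)) (map (λ { (t , q) → (proj₁ a * t , q) }) (insertions x (proj₂ a)))
        ≡ signAt _≟ₗ_ xs a
    insertionsOf {s , p} p↭xs = trans (∑-map (signAt _≟ₗ_ (x ∷ xs)) _ (insertions x p))
                                      (∑-insertions-signAt x xs s p (All-resp-↭ (↭-sym p↭xs) x∉xs))

  ∑-columnPerms-signAt : ∀ Cs → All Unique Cs → ∑ (signAt (List.≡-dec _≟ₗ_) Cs) (columnPerms Cs) ≡ 1ℤ
  ∑-columnPerms-signAt []       _           = refl
  ∑-columnPerms-signAt (c ∷ cs) (!c ∷ !cs) = begin
      ∑ (signAt _≟ₗₗ_ (c ∷ cs)) (columnPerms (c ∷ cs))
    ≡⟨ ∑-concatMap (signAt _≟ₗₗ_ (c ∷ cs)) _ (signedPerms c) ⟩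
      ∑ (λ a → ∑ (signAt _≟ₗₗ_ (c ∷ cs)) (map (λ { (t , q) → (proj₁ a * t , proj₂ a ∷ q) }) (columnPerms cs)))
        (signedPerms c)
    ≡⟨ ∑-cong extendedBy (signedPerms c) ⟩
      ∑ (λ a → signAt _≟ₗ_ c a * 1ℤ) (signedPerms c)
    ≡⟨ ∑-cong (λ a → ℤ.*-identityʳ (signAt _≟ₗ_ c a)) (signedPerms c) ⟩
      ∑ (signAt _≟ₗ_ c) (signedPerms c)
    ≡⟨ ∑-signedPerms-signAt c !c ⟩
      1ℤ
    ∎
    where
    _≟ₗₗ_ : DecidableEquality (List (List A))
    _≟ₗₗ_ = List.≡-dec _≟ₗ_
    extendedBy : ∀ a →
      ∑ (signAt _≟ₗₗ_ (c ∷ cs)) (map (λ { (t , q) → (proj₁ a * t , proj₂ a ∷ q) }) (columnPerms cs))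
        ≡ signAt _≟ₗ_ c a * 1ℤ
    extendedBy (s , p) = begin
        ∑ (signAt _≟ₗₗ_ (c ∷ cs)) (map (λ { (t , q) → (s * t , p ∷ q) }) (columnPerms cs))
      ≡⟨ ∑-map (signAt _≟ₗₗ_ (c ∷ cs)) _ (columnPerms cs) ⟩
        ∑ (λ b → signAt _≟ₗₗ_ (c ∷ cs) (s * proj₁ b , p ∷ proj₂ b)) (columnPerms cs)
      ≡⟨ ∑-cong (λ b → signAt-∷ _≟ₗ_ c cs s (proj₁ b) p (proj₂ b)) (columnPerms cs) ⟩
        ∑ (λ b → signAt _≟ₗ_ c (s , p) * signAt _≟ₗₗ_ cs b) (columnPerms cs)
      ≡⟨ ∑-*ˡ (signAt _≟ₗ_ c (s , p)) (signAt _≟ₗₗ_ cs) (columnPerms cs) ⟩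
        signAt _≟ₗ_ c (s , p) * ∑ (signAt _≟ₗₗ_ cs) (columnPerms cs)
      ≡⟨ cong (signAt _≟ₗ_ c (s , p) *_) (∑-columnPerms-signAt cs !cs) ⟩
        signAt _≟ₗ_ c (s , p) * 1ℤ
      ∎

-- Column permutations with the row contents of a filling with increasing columns

pointwise-≤⇒sum-≤ : ∀ {ms ns} → Pointwise _≤_ ms ns → sum ms ≤ sum ns
pointwise-≤⇒sum-≤ []         = z≤n
pointwise-≤⇒sum-≤ (m≤n ∷ ps) = ℕ.+-mono-≤ m≤n (pointwise-≤⇒sum-≤ ps)

pointwise-≤-sum-≡ : ∀ {ms ns} → Pointwise _≤_ ms ns → sum ns ≤ sum ms → ms ≡ ns
pointwise-≤-sum-≡ []                               _  = refl
pointwise-≤-sum-≡ {m ∷ ms} {n ∷ ns} (m≤n ∷ ps) Σn≤Σm = cong₂ _∷_ m≡n (pointwise-≤-sum-≡ ps Σns≤Σms)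
  where
  Σms≤Σns : sum ms ≤ sum ns
  Σms≤Σns = pointwise-≤⇒sum-≤ ps
  m≡n : m ≡ n
  m≡n = ℕ.≤-antisym m≤n (ℕ.+-cancelʳ-≤ (sum ns) n m (ℕ.≤-trans Σn≤Σm (ℕ.+-monoʳ-≤ m Σms≤Σns)))
  Σns≤Σms : sum ns ≤ sum ms
  Σns≤Σms = ℕ.+-cancelˡ-≤ n (sum ns) (sum ms) (ℕ.≤-trans Σn≤Σm (ℕ.+-monoˡ-≤ (sum ms) m≤n))

allB-sound : ∀ (p : A → Bool) {xs x} → T (allB p xs) → x ∈ xs → T (p x)
allB-sound p {y ∷ ys} all-p (here refl) = proj₁ (Equivalence.to Bool.T-∧ all-p)
allB-sound p {y ∷ ys} all-p (there x∈) = allB-sound p (proj₂ (Equivalence.to Bool.T-∧ all-p)) x∈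

allB-complete : ∀ (p : A → Bool) → (∀ x → T (p x)) → ∀ xs → T (allB p xs)
allB-complete p p-holds []       = _
allB-complete p p-holds (x ∷ xs) = Equivalence.from Bool.T-∧ (p-holds x , allB-complete p p-holds xs)

module _ {n : ℕ} where

  countIn-↭ : ∀ v {xs ys : List (Fin n)} → xs ↭ ys → countIn v xs ≡ countIn v ys
  countIn-↭ v p = ↭-length (filter-↭ (λ x → toℕ x ℕ.≟ toℕ v) p)

  countIn-here : ∀ x (xs : List (Fin n)) → countIn x (x ∷ xs) ≡ suc (countIn x xs)
  countIn-here x xs rewrite ≡ᵇ-refl (toℕ x) = refl

  countIn-∷-cancel : ∀ v x (xs ys : List (Fin n)) →
                     countIn v (x ∷ xs) ≡ countIn v (x ∷ ys) → countIn v xs ≡ countIn v ys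
  countIn-∷-cancel v x xs ys e with toℕ x ℕ.≡ᵇ toℕ v
  ... | true  = ℕ.suc-injective e
  ... | false = e

  countIn-suc⇒∈ : ∀ v (ys : List (Fin n)) {k} → countIn v ys ≡ suc k → v ∈ ys
  countIn-suc⇒∈ v (y ∷ ys) e with toℕ y ℕ.≡ᵇ toℕ v in y≡ᵇv
  ... | true  = here (sym (Fin.toℕ-injective (ℕ.≡ᵇ⇒≡ (toℕ y) (toℕ v) (Equivalence.from Bool.T-≡ y≡ᵇv))))
  ... | false = there (countIn-suc⇒∈ v ys e)

  countIn-≡⇒↭ : ∀ (xs ys : List (Fin n)) → (∀ v → countIn v xs ≡ countIn v ys) → xs ↭ ys
  countIn-≡⇒↭ []       []       _    = ↭-refl
  countIn-≡⇒↭ []       (y ∷ ys) same = ⊥-elim (ℕ.0≢1+n (trans (same y) (countIn-here y ys)))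
  countIn-≡⇒↭ (x ∷ xs) ys       same
    with ∈-∃++ (countIn-suc⇒∈ x ys (trans (sym (same x)) (countIn-here x xs)))
  ... | ys₁ , ys₂ , refl =
    ↭-trans (prep x (countIn-≡⇒↭ xs (ys₁ ++ ys₂) sameRest)) (↭-sym (shift x ys₁ ys₂))
    where
    sameRest : ∀ v → countIn v xs ≡ countIn v (ys₁ ++ ys₂)
    sameRest v = countIn-∷-cancel v x xs (ys₁ ++ ys₂) (trans (same v) (countIn-↭ v (shift x ys₁ ys₂)))

  sameRowContent-refl : ∀ (S : Filling n) → T (sameRowContent S S)
  sameRowContent-refl S =
    allB-complete _ (λ r → allB-complete _ (λ v → ℕ.≡⇒≡ᵇ (countIn v (row r S)) _ refl) (allFin n))
                    (upTo (maxℕ (height S) (height S)))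

  sameRowContent⇒row-↭ : ∀ {G S : Filling n} → T (sameRowContent G S) →
                         ∀ {r} → r < height S → row r G ↭ row r S
  sameRowContent⇒row-↭ {G} {S} same {r} r<h = countIn-≡⇒↭ (row r G) (row r S) λ v →
    ℕ.≡ᵇ⇒≡ _ _ (allB-sound _ (allB-sound _ same (∈-upTo⁺ (ℕ.m≤n⇒m≤o⊔n (height G) r<h))) (∈-allFin v))

  Increasing : List (Fin n) → Set
  Increasing = AllPairs (λ x y → toℕ x < toℕ y)

  -- shifted by one, so that an empty column has a weight of its own
  topWeight : List (Fin n) → ℕ
  topWeight []      = 0
  topWeight (x ∷ _) = suc (toℕ x)

  topWeight-minimal : ∀ {g c} → g ↭ c → Increasing c → topWeight c ≤ topWeight g
  topWeight-minimal {g}     {[]}    _ _ = z≤n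
  topWeight-minimal {[]}    {x ∷ c} p _ = ⊥-elim (¬x∷xs↭[] (↭-sym p))
  topWeight-minimal {y ∷ g} {x ∷ c} p (x<c ∷ _) with ∈-resp-↭ p (here refl)
  ... | here refl = ℕ.≤-refl
  ... | there y∈c = s≤s (ℕ.<⇒≤ (All.lookup x<c y∈c))

  sum-topWeight : ∀ (Xs : List (List (Fin n))) → sum (map topWeight Xs) ≡ sum (map (suc ∘ toℕ) (row 0 Xs))
  sum-topWeight []            = refl
  sum-topWeight ([] ∷ Xs)     = sum-topWeight Xs
  sum-topWeight ((x ∷ _) ∷ Xs) = cong (suc (toℕ x) ℕ.+_) (sum-topWeight Xs)

  row-drop : ∀ r (Xs : List (List (Fin n))) → row r (map (drop 1) Xs) ≡ row (suc r) Xs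
  row-drop r []             = refl
  row-drop r ([] ∷ Xs)      = row-drop r Xs
  row-drop r ((_ ∷ c) ∷ Xs) with nth c r
  ... | just y  = cong (y ∷_) (row-drop r Xs)
  ... | nothing = row-drop r Xs

  drop-top-↭ : ∀ {g c} → g ↭ c → topWeight g ≡ topWeight c → drop 1 g ↭ drop 1 c
  drop-top-↭ {[]}    {[]}    _ _ = ↭-refl
  drop-top-↭ {y ∷ g} {x ∷ c} p e with Fin.toℕ-injective (ℕ.suc-injective e)
  ... | refl = drop-∷ p

  top-drop-injective : ∀ g c → topWeight g ≡ topWeight c → drop 1 g ≡ drop 1 c → g ≡ c
  top-drop-injective []      []      _ _     = refl
  top-drop-injective (y ∷ g) (x ∷ c) e g≡c = cong₂ _∷_ (Fin.toℕ-injective (ℕ.suc-injective e)) g≡c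

  tails-↭ : ∀ {Gs Cs} → Pointwise _↭_ Gs Cs → map topWeight Gs ≡ map topWeight Cs →
            Pointwise _↭_ (map (drop 1) Gs) (map (drop 1) Cs)
  tails-↭ []       _ = []
  tails-↭ (p ∷ ps) e = drop-top-↭ p (List.∷-injectiveˡ e) ∷ tails-↭ ps (List.∷-injectiveʳ e)

  tops-tails-injective : ∀ Gs Cs → map topWeight Gs ≡ map topWeight Cs →
                         map (drop 1) Gs ≡ map (drop 1) Cs → Gs ≡ Cs
  tops-tails-injective []       []       _ _ = refl
  tops-tails-injective (g ∷ Gs) (c ∷ Cs) e e′ =
    cong₂ _∷_ (top-drop-injective g c (List.∷-injectiveˡ e) (List.∷-injectiveˡ e′))
              (tops-tails-injective Gs Cs (List.∷-injectiveʳ e) (List.∷-injectiveʳ e′))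

  topWeights-≤ : ∀ {Gs Cs} → Pointwise _↭_ Gs Cs → All Increasing Cs →
                 Pointwise _≤_ (map topWeight Cs) (map topWeight Gs)
  topWeights-≤ []       []           = []
  topWeights-≤ (p ∷ ps) (inc ∷ incs) = topWeight-minimal p inc ∷ topWeights-≤ ps incs

  tops-agree : ∀ {Gs Cs} → Pointwise _↭_ Gs Cs → All Increasing Cs → row 0 Gs ↭ row 0 Cs →
               map topWeight Gs ≡ map topWeight Cs
  tops-agree {Gs} {Cs} ps incs row₀↭ =
    sym (pointwise-≤-sum-≡ (topWeights-≤ ps incs) (ℕ.≤-reflexive topSums))
    where
    topSums : sum (map topWeight Gs) ≡ sum (map topWeight Cs)
    topSums = trans (sum-topWeight Gs) (trans (sum-↭ (↭-map⁺ (suc ∘ toℕ) row₀↭)) (sym (sum-topWeight Cs)))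

  Increasing-drop : ∀ {c} → Increasing c → Increasing (drop 1 c)
  Increasing-drop []        = []
  Increasing-drop (_ ∷ inc) = inc

  length-drop : ∀ {N} (c : List (Fin n)) → length c ≤ suc N → length (drop 1 c) ≤ N
  length-drop []      _         = z≤n
  length-drop (_ ∷ c) (s≤s c≤N) = c≤N

  columnPerm-rigid : ∀ N {Gs Cs} → Pointwise _↭_ Gs Cs → All Increasing Cs →
                     All (λ c → length c ≤ N) Cs → (∀ {r} → r < N → row r Gs ↭ row r Cs) → Gs ≡ Cs
  columnPerm-rigid zero    []       []        []       _    = refl
  columnPerm-rigid zero {_ ∷ _} {[] ∷ _} (p ∷ ps) (_ ∷ incs) (_ ∷ short) _ =
    cong₂ _∷_ (↭-empty-inv p) (columnPerm-rigid zero ps incs short (λ ()))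
  columnPerm-rigid (suc N) {Gs} {Cs} ps incs short rows =
    tops-tails-injective Gs Cs tops
      (columnPerm-rigid N (tails-↭ ps tops) (All.map⁺ (All.map Increasing-drop incs))
                        (All.map⁺ (All.map (λ {c} → length-drop c) short)) rowsBelow)
    where
    tops : map topWeight Gs ≡ map topWeight Cs
    tops = tops-agree ps incs (rows (s≤s z≤n))
    rowsBelow : ∀ {r} → r < N → row r (map (drop 1) Gs) ↭ row r (map (drop 1) Cs)
    rowsBelow {r} r<N = subst₂ _↭_ (sym (row-drop r Gs)) (sym (row-drop r Cs)) (rows (s≤s r<N))

  RowWeak-length : ∀ {xs ys : List (Fin n)} → RowWeak xs ys → length ys ≤ length xs
  RowWeak-length {xs}     {[]}     _            = z≤n
  RowWeak-length {x ∷ xs} {y ∷ ys} (_ , weak) = s≤s (RowWeak-length weak)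

  columns-shorter : ∀ c cs → Linked RowWeak (c ∷ cs) → All (λ d → length d ≤ length c) (c ∷ cs)
  columns-shorter c []       _              = ℕ.≤-refl ∷ []
  columns-shorter c (d ∷ ds) (weak ∷ linked) =
    ℕ.≤-refl ∷ All.map (λ d′≤d → ℕ.≤-trans d′≤d (RowWeak-length weak)) (columns-shorter d ds linked)

  columns-bounded : ∀ (S : Filling n) → Linked RowWeak S → All (λ c → length c ≤ height S) S
  columns-bounded []       _      = []
  columns-bounded (c ∷ cs) linked = columns-shorter c cs linked

  increasing : ∀ {c : List (Fin n)} → Linked _<_ (map toℕ c) → Increasing c
  increasing l = AllPairs.map⁻ (Linked⇒AllPairs ℕ.<-trans l)

  Increasing⇒Unique : ∀ {c : List (Fin n)} → Increasing c → Unique c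
  Increasing⇒Unique = AllPairs.map (λ x<y x≡y → ℕ.<-irrefl (cong toℕ x≡y) x<y)

  sameRowContent-rigid : ∀ {G S : Filling n} → IsSemistandard S → Pointwise _↭_ G S →
                         T (sameRowContent G S) → G ≡ S
  sameRowContent-rigid {G} {S} (increasingColumns , weakRows) G↭S same =
    columnPerm-rigid (height S) G↭S (All.map increasing increasingColumns) (columns-bounded S weakRows)
                     (sameRowContent⇒row-↭ {G} {S} same)

R-diagonal : ∀ {n} (S : Filling n) → IsSemistandard S → R S S ≡ 1ℤ
R-diagonal {n} S semi@(increasingColumns , _) = begin
    R S S
  ≡⟨ ∑-congᴬ (All.map sameRowContent≡signAt (columnPerms-↭ S)) ⟩
    ∑ (signAt _≟_ S) (columnPerms S)
  ≡⟨ ∑-columnPerms-signAt Fin._≟_ S (All.map (Increasing⇒Unique ∘ increasing) increasingColumns) ⟩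
    1ℤ
  ∎
  where
  _≟_ : DecidableEquality (Filling n)
  _≟_ = List.≡-dec (List.≡-dec Fin._≟_)
  sameRowContent≡signAt : ∀ {a} → Pointwise _↭_ (proj₂ a) S →
                          (if sameRowContent (proj₂ a) S then proj₁ a else 0ℤ) ≡ signAt _≟_ S a
  sameRowContent≡signAt {s , G} G↭S with G ≟ S
  ... | yes refl rewrite Equivalence.to Bool.T-≡ (sameRowContent-refl S) = refl
  ... | no  G≢S with sameRowContent G S in same
  ...   | true  = ⊥-elim (G≢S (sameRowContent-rigid semi G↭S (Equivalence.from Bool.T-≡ same)))
  ...   | false = refl

Rmat-diagonal : ∀ {n} (Ss : List (Filling n)) (i : Fin (length Ss)) →
                Rmat Ss (toℕ i) (toℕ i) ≡ R (lookup Ss i) (lookup Ss i)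
Rmat-diagonal (S ∷ Ss) Fin.zero    = refl
Rmat-diagonal (S ∷ Ss) (Fin.suc i) = Rmat-diagonal Ss i

proposition4p7 : (n : ℕ) → 2 ≤ n →
  (la : List ℕ) → IsPartition la → length la ≤ n →
  (z : Fin n → ℕ) → size z ≡ sum la →
  (Ss : List (Filling n)) →
  (∀ F → (F ∈ Ss) ⇔ (HasShape la F × HasContent z F × IsSemistandard F)) →
  Linked (λ E F → F ≺ E) Ss →
  (i j : Fin (length Ss)) →
  Dcoef (Rmat Ss) (toℕ j) (toℕ i) ≡ chainSum (Rmat Ss) (toℕ i) (toℕ j)
proposition4p7 n _ _ _ _ _ _ Ss tableaux _ i j =
  Dcoef≡chainSum (Rmat Ss) (toℕ i) (trans (Rmat-diagonal Ss i) (R-diagonal Sᵢ Sᵢ-semistandard)) (toℕ j)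
  where
  Sᵢ : Filling n
  Sᵢ = lookup Ss i
  Sᵢ-semistandard : IsSemistandard Sᵢ
  Sᵢ-semistandard = proj₂ (proj₂ (Equivalence.to (tableaux Sᵢ) (∈-lookup i)))
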